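{- For the Boolean lattice $B_n$ (all subsets of an $n$-element set ordered by inclusion), $\mathcal{J}(B_n,t)=(t+1)^n$.
   Context: For a ranked finite poset $\mathcal{S}$ with minimum $\hat0$, maximum $\hat1$ and rank function $\mathrm{rk}$, $\mathcal{J}(\mathcal{S},t)=(-1)^{\mathrm{rk}(\mathcal{S})}\sum_{x\in\mathcal{S}}J(\hat0,x,\hat1)\,t^{\mathrm{rk}(\mathcal{S})-\mathrm{rk}(x)}$, where $J$ is defined on triples $x\le y\le z$ by $\sum_{x\le a\le y\le b\le z}J(a,y,b)=\delta_3(x,y,z)$, $\delta_3(x,y,z)=1$ iff $x=y=z$ (else $0$). In $B_n$ the rank of a subset is its cardinality. -}

module Defs where

open import Data.Bool using (Bool; true; false; if_then_else_)
open import Data.Nat using (ℕ; zero; suc; _∸_)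
open import Data.Integer using (ℤ; +_; _+_; _*_; -_; _^_)
open import Data.List using (List; []; _∷_; map; _++_)
open import Data.Vec using (_∷_; [])
open import Data.Fin.Subset using (Subset; _⊆_; ∣_∣; inside; outside; ⊤; ⊥)
open import Data.Fin.Subset.Properties using (_⊆?_)
open import Data.Vec.Properties using (≡-dec)
import Data.Bool.Properties as BoolP
open import Relation.Nullary using (does)
open import Relation.Binary.PropositionalEquality using (_≡_)

allSubsets : (n : ℕ) → List (Subset n)
allSubsets zero    = [] ∷ []
allSubsets (suc n) = map (outside ∷_) (allSubsets n) ++ map (inside ∷_) (allSubsets n)

sumℤ : ∀ {A : Set} → List A → (A → ℤ) → ℤ
sumℤ []       f = + 0
sumℤ (x ∷ xs) f = f x + sumℤ xs f

sumInterval : ∀ {n} → Subset n → Subset n → (Subset n → ℤ) → ℤ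
sumInterval {n} x y f =
  sumℤ (allSubsets n) (λ a → if does (x ⊆? a) then (if does (a ⊆? y) then f a else + 0) else + 0)

_≟ₛ_ : ∀ {n} (p q : Subset n) → _
_≟ₛ_ = ≡-dec BoolP._≟_

δ₃ : ∀ {n} → Subset n → Subset n → Subset n → ℤ
δ₃ x y z = if does (x ≟ₛ y) then (if does (y ≟ₛ z) then + 1 else + 0) else + 0

IsJ : (n : ℕ) → (Subset n → Subset n → Subset n → ℤ) → Set
IsJ n J = ∀ (x y z : Subset n) → x ⊆ y → y ⊆ z →
  sumInterval x y (λ a → sumInterval y z (λ b → J a y b)) ≡ δ₃ x y z

-- 𝒥(B_n, t) = (-1)^{rk B_n} Σ_x J(0̂,x,1̂) t^{rk B_n - rk x}, rk B_n = n, rk x = |x|,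
-- evaluated at an integer t.
𝒥B : (n : ℕ) → (Subset n → Subset n → Subset n → ℤ) → ℤ → ℤ
𝒥B n J t = ((- + 1) ^ n) * sumℤ (allSubsets n) (λ x → J ⊥ x ⊤ * (t ^ (n ∸ ∣ x ∣)))

-- In B_n the Möbius function is μ(x,y) = (-1)^(|y|-|x|). Inverting the defining
-- relation of J first in its lower variable x and then in its upper variable z expresses
-- J(∅,y,[n]) as the double alternating sum Σ_{x ⊆ y ⊆ z} (-1)^(|x| + n - |z|) δ₃(x,y,z) = (-1)^n,
-- independently of y.  The sign then cancels against the prefactor of 𝒥, leaving
-- Σ_x t^(n-|x|) = (t+1)^n.

module Submission where

open import Defs
open import Data.Nat using (ℕ)
open import Data.Integer using (ℤ; +_; _+_; _^_)
open import Data.Fin.Subset using (Subset)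
open import Relation.Binary.PropositionalEquality using (_≡_)

open import Data.Nat using (zero; suc; _∸_)
import Data.Nat as ℕ
import Data.Nat.Properties as ℕₚ
open import Data.Integer using (_*_; 0ℤ; 1ℤ; -1ℤ)
open import Data.Integer.Properties using (+-identityˡ; +-identityʳ; +-assoc; *-zeroʳ; *-identityˡ; *-identityʳ; *-assoc; *-distribˡ-+; ^-distribˡ-+-*)
open import Data.Integer.Tactic.RingSolver using (solve-∀)
open import Data.Bool using (true; false; if_then_else_)
open import Data.Bool.Properties using (if-eta)
open import Data.List using (List; []; _∷_; map; _++_)
open import Data.Vec using (_∷_; [])
open import Data.Vec.Properties using (∷-injectiveʳ)
open import Data.Fin.Subset using (∣_∣; ∁; inside; outside; ⊤; ⊥)
open import Data.Fin.Subset.Properties using (_⊆?_; ⊆-refl; ∣p∣≤n; ∣∁p∣≡n∸∣p∣)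
open import Relation.Nullary using (does; yes; no)
open import Relation.Nullary.Decidable using (dec-true; dec-false)
open import Relation.Unary using (Pred; Decidable)
open import Relation.Binary.PropositionalEquality using (_≢_; refl; sym; trans; cong; cong₂; module ≡-Reasoning)
open import Level using (0ℓ)

open ≡-Reasoning

module _ {A : Set} where

  sumℤ-cong : (xs : List A) {f g : A → ℤ} → (∀ x → f x ≡ g x) → sumℤ xs f ≡ sumℤ xs g
  sumℤ-cong []       f≗g = refl
  sumℤ-cong (x ∷ xs) f≗g = cong₂ _+_ (f≗g x) (sumℤ-cong xs f≗g)

  sumℤ-zero : (xs : List A) → sumℤ xs (λ _ → 0ℤ) ≡ 0ℤ
  sumℤ-zero []       = refl
  sumℤ-zero (x ∷ xs) = trans (+-identityˡ _) (sumℤ-zero xs)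

  sumℤ-++ : (xs ys : List A) (f : A → ℤ) → sumℤ (xs ++ ys) f ≡ sumℤ xs f + sumℤ ys f
  sumℤ-++ []       ys f = sym (+-identityˡ _)
  sumℤ-++ (x ∷ xs) ys f = trans (cong (_+_ (f x)) (sumℤ-++ xs ys f)) (sym (+-assoc (f x) _ _))

  sumℤ-+ : (xs : List A) (f g : A → ℤ) → sumℤ xs (λ x → f x + g x) ≡ sumℤ xs f + sumℤ xs g
  sumℤ-+ []       f g = refl
  sumℤ-+ (x ∷ xs) f g = trans (cong (_+_ (f x + g x)) (sumℤ-+ xs f g)) (interchange (f x) (g x) _ _)
    where
    interchange : ∀ a b c d → a + b + (c + d) ≡ a + c + (b + d)
    interchange = solve-∀

  sumℤ-*ˡ : (xs : List A) (c : ℤ) (f : A → ℤ) → sumℤ xs (λ x → c * f x) ≡ c * sumℤ xs f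
  sumℤ-*ˡ []       c f = sym (*-zeroʳ c)
  sumℤ-*ˡ (x ∷ xs) c f = trans (cong (_+_ (c * f x)) (sumℤ-*ˡ xs c f)) (sym (*-distribˡ-+ c (f x) _))

sumℤ-map : ∀ {A B : Set} (g : A → B) (xs : List A) (f : B → ℤ) →
  sumℤ (map g xs) f ≡ sumℤ xs (λ x → f (g x))
sumℤ-map g []       f = refl
sumℤ-map g (x ∷ xs) f = cong (_+_ (f (g x))) (sumℤ-map g xs f)

sumℤ-allSubsets-suc : ∀ n (f : Subset (suc n) → ℤ) → sumℤ (allSubsets (suc n)) f ≡
  sumℤ (allSubsets n) (λ x → f (outside ∷ x)) + sumℤ (allSubsets n) (λ x → f (inside ∷ x))
sumℤ-allSubsets-suc n f = trans (sumℤ-++ (map (outside ∷_) (allSubsets n)) _ f)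
  (cong₂ _+_ (sumℤ-map _ (allSubsets n) f) (sumℤ-map _ (allSubsets n) f))

sumℤ-allSubsets-point : ∀ n {f : Subset n → ℤ} (y : Subset n) →
  (∀ x → x ≢ y → f x ≡ 0ℤ) → sumℤ (allSubsets n) f ≡ f y
sumℤ-allSubsets-point zero    []            vanish = +-identityʳ _
sumℤ-allSubsets-point (suc n) {f} (outside ∷ y) vanish = begin
  sumℤ (allSubsets (suc n)) f
    ≡⟨ sumℤ-allSubsets-suc n f ⟩
  sumℤ (allSubsets n) (λ x → f (outside ∷ x)) + sumℤ (allSubsets n) (λ x → f (inside ∷ x))
    ≡⟨ cong₂ _+_ (sumℤ-allSubsets-point n y λ x x≢y → vanish _ λ e → x≢y (∷-injectiveʳ e))
                 (trans (sumℤ-cong (allSubsets n) λ x → vanish _ λ ()) (sumℤ-zero (allSubsets n))) ⟩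
  f (outside ∷ y) + 0ℤ
    ≡⟨ +-identityʳ _ ⟩
  f (outside ∷ y) ∎
sumℤ-allSubsets-point (suc n) {f} (inside ∷ y) vanish = begin
  sumℤ (allSubsets (suc n)) f
    ≡⟨ sumℤ-allSubsets-suc n f ⟩
  sumℤ (allSubsets n) (λ x → f (outside ∷ x)) + sumℤ (allSubsets n) (λ x → f (inside ∷ x))
    ≡⟨ cong₂ _+_ (trans (sumℤ-cong (allSubsets n) λ x → vanish _ λ ()) (sumℤ-zero (allSubsets n)))
                 (sumℤ-allSubsets-point n y λ x x≢y → vanish _ λ e → x≢y (∷-injectiveʳ e)) ⟩
  0ℤ + f (inside ∷ y)
    ≡⟨ +-identityˡ _ ⟩
  f (inside ∷ y) ∎

guardedSum : ∀ {n} {P : Pred (Subset n) 0ℓ} → Decidable P → (Subset n → ℤ) → ℤ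
guardedSum {n} P? f = sumℤ (allSubsets n) (λ x → if does (P? x) then f x else 0ℤ)

module _ {n} {P : Pred (Subset n) 0ℓ} (P? : Decidable P) where

  guardedSum-cong : {f g : Subset n → ℤ} → (∀ {x} → P x → f x ≡ g x) →
    guardedSum P? f ≡ guardedSum P? g
  guardedSum-cong {f} {g} f≗g = sumℤ-cong (allSubsets n) pointwise
    where
    pointwise : ∀ x → (if does (P? x) then f x else 0ℤ) ≡ (if does (P? x) then g x else 0ℤ)
    pointwise x with P? x
    ... | yes Px = f≗g Px
    ... | no  _  = refl

  guardedSum-+ : (f g : Subset n → ℤ) →
    guardedSum P? f + guardedSum P? g ≡ guardedSum P? (λ x → f x + g x)
  guardedSum-+ f g = trans (sym (sumℤ-+ (allSubsets n) _ _)) (sumℤ-cong (allSubsets n) pointwise)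
    where
    pointwise : ∀ x → (if does (P? x) then f x else 0ℤ) + (if does (P? x) then g x else 0ℤ)
                    ≡ (if does (P? x) then f x + g x else 0ℤ)
    pointwise x with does (P? x)
    ... | true  = refl
    ... | false = refl

  guardedSum-point : {f : Subset n → ℤ} (y : Subset n) → P y → (∀ x → x ≢ y → f x ≡ 0ℤ) →
    guardedSum P? f ≡ f y
  guardedSum-point {f} y Py vanish = trans
    (sumℤ-allSubsets-point n y λ x x≢y → trans (cong (if does (P? x) then_else 0ℤ) (vanish x x≢y)) (if-eta _))
    (cong (if_then f y else 0ℤ) (dec-true (P? y) Py))

-- Here and in the Möbius inversions, summands whose ⊆?-guard fails on the head bit
-- (inside versus outside) reduce to 0 by computation, leaving bare sums of 0ℤ.
module _ {n} (x y : Subset n) (h : Subset (suc n) → ℤ) where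

  sumInterval-outside : sumInterval (outside ∷ x) (outside ∷ y) h ≡ sumInterval x y (λ a → h (outside ∷ a))
  sumInterval-outside = begin
    sumInterval (outside ∷ x) (outside ∷ y) h
      ≡⟨ sumℤ-allSubsets-suc n _ ⟩
    sumInterval x y (λ a → h (outside ∷ a)) + sumℤ (allSubsets n) (λ a → if does (x ⊆? a) then 0ℤ else 0ℤ)
      ≡⟨ cong (_+_ (sumInterval x y (λ a → h (outside ∷ a))))
              (trans (sumℤ-cong (allSubsets n) λ a → if-eta (does (x ⊆? a))) (sumℤ-zero (allSubsets n))) ⟩
    sumInterval x y (λ a → h (outside ∷ a)) + 0ℤ
      ≡⟨ +-identityʳ _ ⟩
    sumInterval x y (λ a → h (outside ∷ a)) ∎

  sumInterval-inside : sumInterval (inside ∷ x) (inside ∷ y) h ≡ sumInterval x y (λ a → h (inside ∷ a))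
  sumInterval-inside = trans (sumℤ-allSubsets-suc n _)
    (trans (cong (_+ sumInterval x y (λ a → h (inside ∷ a))) (sumℤ-zero (allSubsets n))) (+-identityˡ _))

  sumInterval-outside-inside : sumInterval (outside ∷ x) (inside ∷ y) h ≡
    sumInterval x y (λ a → h (outside ∷ a)) + sumInterval x y (λ a → h (inside ∷ a))
  sumInterval-outside-inside = sumℤ-allSubsets-suc n _

parity : ∀ {n} → Subset n → ℤ
parity x = -1ℤ ^ ∣ x ∣

coparity : ∀ {n} → Subset n → ℤ
coparity x = parity (∁ x)

coparity*parity : ∀ n (x : Subset n) → coparity x * parity x ≡ -1ℤ ^ n
coparity*parity n x = begin
  -1ℤ ^ ∣ ∁ x ∣ * -1ℤ ^ ∣ x ∣   ≡⟨ sym (^-distribˡ-+-* -1ℤ ∣ ∁ x ∣ ∣ x ∣) ⟩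
  -1ℤ ^ (∣ ∁ x ∣ ℕ.+ ∣ x ∣)     ≡⟨ cong (λ k → -1ℤ ^ (k ℕ.+ ∣ x ∣)) (∣∁p∣≡n∸∣p∣ x) ⟩
  -1ℤ ^ (n ∸ ∣ x ∣ ℕ.+ ∣ x ∣)   ≡⟨ cong (-1ℤ ^_) (ℕₚ.m∸n+n≡m (∣p∣≤n x)) ⟩
  -1ℤ ^ n                        ∎

möbius-inversion-⊥ : ∀ n (y : Subset n) (h : Subset n → ℤ) →
  guardedSum (_⊆? y) (λ x → parity x * sumInterval x y h) ≡ h ⊥
möbius-inversion-⊥ zero [] h = trans (+-identityʳ _) (trans (*-identityˡ _) (+-identityʳ _))
möbius-inversion-⊥ (suc n) (outside ∷ y) h = begin
  guardedSum (_⊆? outside ∷ y) (λ x → parity x * sumInterval x (outside ∷ y) h)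
    ≡⟨ sumℤ-allSubsets-suc n _ ⟩
  guardedSum (_⊆? y) (λ x → parity x * sumInterval (outside ∷ x) (outside ∷ y) h)
    + sumℤ (allSubsets n) (λ _ → 0ℤ)
    ≡⟨ cong₂ _+_ (guardedSum-cong (_⊆? y) λ {x} _ → cong (parity x *_) (sumInterval-outside x y h))
                 (sumℤ-zero (allSubsets n)) ⟩
  guardedSum (_⊆? y) (λ x → parity x * sumInterval x y (λ a → h (outside ∷ a))) + 0ℤ
    ≡⟨ +-identityʳ _ ⟩
  guardedSum (_⊆? y) (λ x → parity x * sumInterval x y (λ a → h (outside ∷ a)))
    ≡⟨ möbius-inversion-⊥ n y (λ a → h (outside ∷ a)) ⟩
  h ⊥ ∎
möbius-inversion-⊥ (suc n) (inside ∷ y) h = begin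
  guardedSum (_⊆? inside ∷ y) (λ x → parity x * sumInterval x (inside ∷ y) h)
    ≡⟨ sumℤ-allSubsets-suc n _ ⟩
  guardedSum (_⊆? y) (λ x → parity x * sumInterval (outside ∷ x) (inside ∷ y) h)
    + guardedSum (_⊆? y) (λ x → -1ℤ * parity x * sumInterval (inside ∷ x) (inside ∷ y) h)
    ≡⟨ guardedSum-+ (_⊆? y) _ _ ⟩
  guardedSum (_⊆? y) (λ x → parity x * sumInterval (outside ∷ x) (inside ∷ y) h
                          + -1ℤ * parity x * sumInterval (inside ∷ x) (inside ∷ y) h)
    ≡⟨ guardedSum-cong (_⊆? y) (λ {x} _ → cancel x) ⟩
  guardedSum (_⊆? y) (λ x → parity x * sumInterval x y (λ a → h (outside ∷ a)))
    ≡⟨ möbius-inversion-⊥ n y (λ a → h (outside ∷ a)) ⟩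
  h ⊥ ∎
  where
  cancel : ∀ x → parity x * sumInterval (outside ∷ x) (inside ∷ y) h
               + -1ℤ * parity x * sumInterval (inside ∷ x) (inside ∷ y) h
               ≡ parity x * sumInterval x y (λ a → h (outside ∷ a))
  cancel x = trans (cong₂ (λ u v → parity x * u + -1ℤ * parity x * v)
                          (sumInterval-outside-inside x y h) (sumInterval-inside x y h))
                   (ring (parity x) _ _)
    where
    ring : ∀ s a b → s * (a + b) + -1ℤ * s * b ≡ s * a
    ring = solve-∀

möbius-inversion-⊤ : ∀ n (y : Subset n) (k : Subset n → ℤ) →
  guardedSum (y ⊆?_) (λ z → coparity z * sumInterval y z k) ≡ k ⊤
möbius-inversion-⊤ zero [] k = trans (+-identityʳ _) (trans (*-identityˡ _) (+-identityʳ _))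
möbius-inversion-⊤ (suc n) (inside ∷ y) k = begin
  guardedSum (inside ∷ y ⊆?_) (λ z → coparity z * sumInterval (inside ∷ y) z k)
    ≡⟨ sumℤ-allSubsets-suc n _ ⟩
  sumℤ (allSubsets n) (λ _ → 0ℤ)
    + guardedSum (y ⊆?_) (λ z → coparity z * sumInterval (inside ∷ y) (inside ∷ z) k)
    ≡⟨ cong₂ _+_ (sumℤ-zero (allSubsets n))
                 (guardedSum-cong (y ⊆?_) λ {z} _ → cong (coparity z *_) (sumInterval-inside y z k)) ⟩
  0ℤ + guardedSum (y ⊆?_) (λ z → coparity z * sumInterval y z (λ b → k (inside ∷ b)))
    ≡⟨ +-identityˡ _ ⟩
  guardedSum (y ⊆?_) (λ z → coparity z * sumInterval y z (λ b → k (inside ∷ b)))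
    ≡⟨ möbius-inversion-⊤ n y (λ b → k (inside ∷ b)) ⟩
  k ⊤ ∎
möbius-inversion-⊤ (suc n) (outside ∷ y) k = begin
  guardedSum (outside ∷ y ⊆?_) (λ z → coparity z * sumInterval (outside ∷ y) z k)
    ≡⟨ sumℤ-allSubsets-suc n _ ⟩
  guardedSum (y ⊆?_) (λ z → -1ℤ * coparity z * sumInterval (outside ∷ y) (outside ∷ z) k)
    + guardedSum (y ⊆?_) (λ z → coparity z * sumInterval (outside ∷ y) (inside ∷ z) k)
    ≡⟨ guardedSum-+ (y ⊆?_) _ _ ⟩
  guardedSum (y ⊆?_) (λ z → -1ℤ * coparity z * sumInterval (outside ∷ y) (outside ∷ z) k
                          + coparity z * sumInterval (outside ∷ y) (inside ∷ z) k)
    ≡⟨ guardedSum-cong (y ⊆?_) (λ {z} _ → cancel z) ⟩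
  guardedSum (y ⊆?_) (λ z → coparity z * sumInterval y z (λ b → k (inside ∷ b)))
    ≡⟨ möbius-inversion-⊤ n y (λ b → k (inside ∷ b)) ⟩
  k ⊤ ∎
  where
  cancel : ∀ z → -1ℤ * coparity z * sumInterval (outside ∷ y) (outside ∷ z) k
               + coparity z * sumInterval (outside ∷ y) (inside ∷ z) k
               ≡ coparity z * sumInterval y z (λ b → k (inside ∷ b))
  cancel z = trans (cong₂ (λ u v → -1ℤ * coparity z * u + coparity z * v)
                          (sumInterval-outside y z k) (sumInterval-outside-inside y z k))
                   (ring (coparity z) _ _)
    where
    ring : ∀ s a b → -1ℤ * s * a + s * (a + b) ≡ s * b
    ring = solve-∀

module _ {n} {x y z : Subset n} where

  δ₃-≢ˡ : x ≢ y → δ₃ x y z ≡ 0ℤ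
  δ₃-≢ˡ x≢y = cong (if_then _ else 0ℤ) (dec-false (x ≟ₛ y) x≢y)

  δ₃-≢ʳ : y ≢ z → δ₃ x y z ≡ 0ℤ
  δ₃-≢ʳ y≢z = trans (cong (λ b → if does (x ≟ₛ y) then (if b then 1ℤ else 0ℤ) else 0ℤ) (dec-false (y ≟ₛ z) y≢z))
                    (if-eta (does (x ≟ₛ y)))

δ₃-refl : ∀ {n} (x : Subset n) → δ₃ x x x ≡ 1ℤ
δ₃-refl x = cong (λ b → if b then (if b then 1ℤ else 0ℤ) else 0ℤ) (dec-true (x ≟ₛ x) refl)

alternating-sum-δ₃ : ∀ n (y : Subset n) →
  guardedSum (y ⊆?_) (λ z → coparity z * guardedSum (_⊆? y) (λ x → parity x * δ₃ x y z)) ≡ -1ℤ ^ n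
alternating-sum-δ₃ n y = begin
  guardedSum (y ⊆?_) (λ z → coparity z * guardedSum (_⊆? y) (λ x → parity x * δ₃ x y z))
    ≡⟨ guardedSum-cong (y ⊆?_) (λ {z} _ → cong (coparity z *_)
         (guardedSum-point (_⊆? y) y ⊆-refl λ x x≢y → trans (cong (parity x *_) (δ₃-≢ˡ x≢y)) (*-zeroʳ (parity x)))) ⟩
  guardedSum (y ⊆?_) (λ z → coparity z * (parity y * δ₃ y y z))
    ≡⟨ guardedSum-point (y ⊆?_) y ⊆-refl (λ z z≢y →
         trans (cong (λ d → coparity z * (parity y * d)) (δ₃-≢ʳ {x = y} λ y≡z → z≢y (sym y≡z)))
               (trans (cong (coparity z *_) (*-zeroʳ (parity y))) (*-zeroʳ (coparity z)))) ⟩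
  coparity y * (parity y * δ₃ y y y)
    ≡⟨ cong (λ d → coparity y * (parity y * d)) (δ₃-refl y) ⟩
  coparity y * (parity y * 1ℤ)
    ≡⟨ cong (coparity y *_) (*-identityʳ (parity y)) ⟩
  coparity y * parity y
    ≡⟨ coparity*parity n y ⟩
  -1ℤ ^ n ∎

J-⊥-⊤ : ∀ n {J : Subset n → Subset n → Subset n → ℤ} → IsJ n J → ∀ y → J ⊥ y ⊤ ≡ -1ℤ ^ n
J-⊥-⊤ n {J} isJ y = begin
  J ⊥ y ⊤
    ≡⟨ sym (möbius-inversion-⊤ n y (J ⊥ y)) ⟩
  guardedSum (y ⊆?_) (λ z → coparity z * sumInterval y z (J ⊥ y))
    ≡⟨ guardedSum-cong (y ⊆?_) (λ {z} _ → cong (coparity z *_)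
         (sym (möbius-inversion-⊥ n y λ a → sumInterval y z (J a y)))) ⟩
  guardedSum (y ⊆?_) (λ z → coparity z *
    guardedSum (_⊆? y) (λ x → parity x * sumInterval x y (λ a → sumInterval y z (J a y))))
    ≡⟨ guardedSum-cong (y ⊆?_) (λ {z} y⊆z → cong (coparity z *_)
         (guardedSum-cong (_⊆? y) λ {x} x⊆y → cong (parity x *_) (isJ x y z x⊆y y⊆z))) ⟩
  guardedSum (y ⊆?_) (λ z → coparity z * guardedSum (_⊆? y) (λ x → parity x * δ₃ x y z))
    ≡⟨ alternating-sum-δ₃ n y ⟩
  -1ℤ ^ n ∎

sumℤ-^-∣∁∣ : ∀ n (t : ℤ) → sumℤ (allSubsets n) (λ x → t ^ ∣ ∁ x ∣) ≡ (t + 1ℤ) ^ n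
sumℤ-^-∣∁∣ zero    t = refl
sumℤ-^-∣∁∣ (suc n) t = begin
  sumℤ (allSubsets (suc n)) (λ x → t ^ ∣ ∁ x ∣)
    ≡⟨ sumℤ-allSubsets-suc n _ ⟩
  sumℤ (allSubsets n) (λ x → t * t ^ ∣ ∁ x ∣) + sumℤ (allSubsets n) (λ x → t ^ ∣ ∁ x ∣)
    ≡⟨ cong (_+ sumℤ (allSubsets n) (λ x → t ^ ∣ ∁ x ∣)) (sumℤ-*ˡ (allSubsets n) t _) ⟩
  t * sumℤ (allSubsets n) (λ x → t ^ ∣ ∁ x ∣) + sumℤ (allSubsets n) (λ x → t ^ ∣ ∁ x ∣)
    ≡⟨ cong (λ s → t * s + s) (sumℤ-^-∣∁∣ n t) ⟩
  t * (t + 1ℤ) ^ n + (t + 1ℤ) ^ n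
    ≡⟨ ring t ((t + 1ℤ) ^ n) ⟩
  (t + 1ℤ) * (t + 1ℤ) ^ n ∎
  where
  ring : ∀ t p → t * p + p ≡ (t + 1ℤ) * p
  ring = solve-∀

-1^n*-1^n≡1 : ∀ n → -1ℤ ^ n * -1ℤ ^ n ≡ 1ℤ
-1^n*-1^n≡1 zero    = refl
-1^n*-1^n≡1 (suc n) = trans (ring (-1ℤ ^ n)) (-1^n*-1^n≡1 n)
  where
  ring : ∀ s → -1ℤ * s * (-1ℤ * s) ≡ s * s
  ring = solve-∀

proposition6p7 : (n : ℕ) (J : Subset n → Subset n → Subset n → ℤ) → IsJ n J →
    (t : ℤ) → 𝒥B n J t ≡ (t + + 1) ^ n
proposition6p7 n J isJ t = begin
  -1ℤ ^ n * sumℤ (allSubsets n) (λ x → J ⊥ x ⊤ * t ^ (n ∸ ∣ x ∣))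
    ≡⟨ cong (-1ℤ ^ n *_) (sumℤ-cong (allSubsets n) λ x →
         cong₂ _*_ (J-⊥-⊤ n isJ x) (cong (t ^_) (sym (∣∁p∣≡n∸∣p∣ x)))) ⟩
  -1ℤ ^ n * sumℤ (allSubsets n) (λ x → -1ℤ ^ n * t ^ ∣ ∁ x ∣)
    ≡⟨ cong (-1ℤ ^ n *_) (sumℤ-*ˡ (allSubsets n) (-1ℤ ^ n) _) ⟩
  -1ℤ ^ n * (-1ℤ ^ n * sumℤ (allSubsets n) (λ x → t ^ ∣ ∁ x ∣))
    ≡⟨ sym (*-assoc (-1ℤ ^ n) _ _) ⟩
  -1ℤ ^ n * -1ℤ ^ n * sumℤ (allSubsets n) (λ x → t ^ ∣ ∁ x ∣)
    ≡⟨ cong₂ _*_ (-1^n*-1^n≡1 n) (sumℤ-^-∣∁∣ n t) ⟩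
  1ℤ * (t + 1ℤ) ^ n
    ≡⟨ *-identityˡ _ ⟩
  (t + 1ℤ) ^ n ∎
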